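{- Let $m\ge 1$ be an integer. Define the polynomial $p_{m-1}(t)=\prod_{r=1}^{m-1}\left(1-\frac{t}{r}\right)$ (with $p_0=1$) and the coefficients $a_{m-1,j}$ by $p_{m-1}(t)=\sum_{j=0}^{m-1}(-1)^j a_{m-1,j}t^j$. Similarly let $p_m(t)=\prod_{r=1}^{m}\left(1-\frac{t}{r}\right)=\sum_{j=0}^m(-1)^j a_{m,j}t^j$ and define the rational function \[ G_m(s)=\sum_{j=0}^m (-1)^j\frac{a_{m,j}}{s+j-1}. \] Then, as an identity of rational functions of $s$, \[ m\,s(s-1)\,G_m(s)=\sum_{j=0}^{m-1}\frac{(j+1)!\,a_{m-1,j}}{(s+1)(s+2)\cdots(s+j)} = a_{m-1,0}+\frac{2a_{m-1,1}}{s+1}+\frac{6a_{m-1,2}}{(s+1)(s+2)}+\cdots, \] where the $j=0$ term has empty denominator product equal to $1$. -}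

module Defs where

open import Data.Nat as ℕ using (ℕ; zero; suc)
open import Data.Integer using (+_)
open import Data.Rational using (ℚ; 0ℚ; 1ℚ; _+_; _-_; _*_; -_; _/_; 1/_; ≢-nonZero)
open import Data.Rational.Properties using (_≟_)
open import Relation.Nullary using (yes; no)

ι : ℕ → ℚ
ι n = + n / 1

-- total division: x ÷₀ y = x / y when y ≠ 0 (and 0 when y = 0; that case is
-- never used in the statement, since all denominators are assumed nonzero)
_÷₀_ : ℚ → ℚ → ℚ
x ÷₀ y with y ≟ 0ℚ
... | yes _ = 0ℚ
... | no y≢0 = x * 1/_ y {{≢-nonZero y≢0}}

sumBelow : ℕ → (ℕ → ℚ) → ℚ
sumBelow zero    f = 0ℚ
sumBelow (suc n) f = sumBelow n f + f n

risingFrom1 : ℚ → ℕ → ℚ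
risingFrom1 s zero    = 1ℚ
risingFrom1 s (suc j) = risingFrom1 s j * (s + ι (suc j))

sgn : ℕ → ℚ
sgn zero    = 1ℚ
sgn (suc j) = - sgn j

-- coeff m j = coefficient of t^j in p_m(t) = ∏_{r=1}^{m} (1 - t/r),
-- computed by expanding p_{m+1}(t) = p_m(t) · (1 - t/(m+1)).
coeff : ℕ → ℕ → ℚ
coeff zero    zero    = 1ℚ
coeff zero    (suc j) = 0ℚ
coeff (suc m) zero    = coeff m zero
coeff (suc m) (suc j) = coeff m (suc j) - coeff m j * (+ 1 / suc m)

a : ℕ → ℕ → ℚ
a m j = sgn j * coeff m j

G : ℕ → ℚ → ℚ
G m s = sumBelow (suc m) (λ j → (sgn j * a m j) ÷₀ (s + ι j - 1ℚ))

-- Write c_{m,j} for the coefficient of t^j in p_m(t), so a_{m,j} = (-1)^j c_{m,j} and,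
-- the signs (-1)^j (-1)^j cancelling, G_m(s) = Σ_{j≤m} c_{m,j} / (s + j - 1).  Put
-- T_j(s) = (j+1)! / ((s+1)⋯(s+j)) and R_n(s) = Σ_{j≤n} a_{n,j} T_j(s); the theorem says
-- m s (s-1) G_m(s) = R_{m-1}(s), which we prove by induction on m ≥ 1.
-- Both sides inherit a recurrence in m from p_{n+1}(t) = p_n(t) (1 - t/(n+1)):
--   G_{n+1}(s) = G_n(s) - G_n(s+1)/(n+1)       (the index shift j ↦ j+1 is s ↦ s+1),
--   R_{n+1}(s) = R_n(s) + (1/(n+1)) Σ_{j≤n} a_{n,j} T_{j+1}(s),
-- and the telescoping identity (s-1)/(s+1) · T_j(s+1) = T_j(s) - T_{j+1}(s) turns the last
-- sum into R_n(s) - (s-1)/(s+1) · R_n(s+1).  Inserting the induction hypothesis at s and at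
-- s+1 into the two recurrences closes the step by field arithmetic; m = 1 is computed.
-- Division is handled through a total reciprocal (inverse of 0 is 0), for which the
-- product rule holds unconditionally; this keeps nonvanishing side conditions minimal.

module Submission where

open import Defs
open import Data.Nat using (ℕ; suc; _≤_; _∸_; _!)
open import Data.Rational using (ℚ; 0ℚ; 1ℚ; _+_; _-_; _*_)
open import Relation.Binary.PropositionalEquality using (_≡_; _≢_)

open import Level using (0ℓ)
open import Data.Nat as ℕ using (zero; z≤n; s≤s; _<_)
open import Data.Nat.Properties using (≤-refl; m<n⇒m<1+n; m≤n⇒m≤1+n)
open import Data.Nat.Coprimality using (1-coprimeTo) renaming (sym to coprime-sym)
open import Data.Integer as ℤ using (+_)
import Data.Integer.Properties as ℤ
open import Data.Rational using (mkℚ; _/_; -_; ≢-nonZero)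
open import Data.Rational.Properties
  using (_≟_; normalize-coprime; +-*-commutativeRing; *-inverseʳ; *-identityˡ; *-identityʳ;
         *-zeroˡ; *-zeroʳ; *-comm; +-identityʳ)
open import Data.Maybe using (Maybe; just; nothing)
open import Data.Empty using (⊥-elim)
open import Relation.Nullary using (Dec; yes; no)
open import Relation.Binary.PropositionalEquality using (refl; sym; trans; cong; cong₂; module ≡-Reasoning)
open import Tactic.RingSolver using (solve-∀)
open import Tactic.RingSolver.Core.AlmostCommutativeRing using (AlmostCommutativeRing; fromCommutativeRing)
open ≡-Reasoning

ℚ-ring : AlmostCommutativeRing 0ℓ 0ℓ
ℚ-ring = fromCommutativeRing +-*-commutativeRing isZero
  where
  isZero : ∀ x → Maybe (0ℚ ≡ x)
  isZero x with 0ℚ ≟ x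
  ... | yes 0≡x = just 0≡x
  ... | no _    = nothing

ι-as-mkℚ : ∀ n → ι n ≡ mkℚ (+ n) 0 (coprime-sym (1-coprimeTo n))
ι-as-mkℚ n = normalize-coprime (coprime-sym (1-coprimeTo n))

ι-suc : ∀ n → ι (suc n) ≡ 1ℚ + ι n
ι-suc n rewrite ι-as-mkℚ n = cong (λ z → (+ 1 ℤ.+ z) / 1) (sym (ℤ.*-identityʳ (+ n)))

ι-* : ∀ m n → ι (m ℕ.* n) ≡ ι m * ι n
ι-* m n rewrite ι-as-mkℚ m | ι-as-mkℚ n = cong (λ z → z / 1) (ℤ.pos-* m n)

ι-reciprocal : ∀ n → ι (suc n) * (+ 1 / suc n) ≡ 1ℚ
ι-reciprocal n rewrite ι-as-mkℚ (suc n) | normalize-coprime {1} {n} (1-coprimeTo (suc n)) =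
  *-inverseʳ (mkℚ (+ suc n) 0 (coprime-sym (1-coprimeTo (suc n))))

inv : ℚ → ℚ
inv y = 1ℚ ÷₀ y

÷₀-as-inv : ∀ x y → x ÷₀ y ≡ x * inv y
÷₀-as-inv x y with y ≟ 0ℚ
... | yes _ = sym (*-zeroʳ x)
... | no _  = cong (x *_) (sym (*-identityˡ _))

inv-inverseʳ : ∀ {y} → y ≢ 0ℚ → y * inv y ≡ 1ℚ
inv-inverseʳ {y} y≢0 with y ≟ 0ℚ
... | yes y≡0 = ⊥-elim (y≢0 y≡0)
... | no y≢0′ = trans (cong (y *_) (*-identityˡ _)) (*-inverseʳ y {{≢-nonZero y≢0′}})

inv-unique : ∀ z w → z * w ≡ 1ℚ → inv z ≡ w
inv-unique z w zw≡1 = begin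
  inv z                ≡⟨ sym (*-identityʳ _) ⟩
  inv z * 1ℚ           ≡⟨ cong (inv z *_) (sym zw≡1) ⟩
  inv z * (z * w)      ≡⟨ reassociate z (inv z) w ⟩
  (z * inv z) * w      ≡⟨ cong (_* w) (inv-inverseʳ z≢0) ⟩
  1ℚ * w               ≡⟨ *-identityˡ w ⟩
  w                    ∎
  where
  reassociate : ∀ z iz w → iz * (z * w) ≡ (z * iz) * w
  reassociate = solve-∀ ℚ-ring
  z≢0 : z ≢ 0ℚ
  z≢0 z≡0 = 1≢0 (trans (sym zw≡1) (trans (cong (_* w) z≡0) (*-zeroˡ w)))
    where
    1≢0 : 1ℚ ≢ 0ℚ
    1≢0 ()

-- Because inv 0 = 0, the reciprocal is multiplicative without any side condition.
inv-* : ∀ x y → inv (x * y) ≡ inv x * inv y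
inv-* x y = by-cases (x ≟ 0ℚ) (y ≟ 0ℚ)
  where
  inv-zero : inv 0ℚ ≡ 0ℚ
  inv-zero = refl
  interchange : ∀ x ix y iy → (x * y) * (ix * iy) ≡ (x * ix) * (y * iy)
  interchange = solve-∀ ℚ-ring
  by-cases : Dec (x ≡ 0ℚ) → Dec (y ≡ 0ℚ) → inv (x * y) ≡ inv x * inv y
  by-cases (yes x≡0) _ = begin
    inv (x * y)      ≡⟨ cong (λ z → inv (z * y)) x≡0 ⟩
    inv (0ℚ * y)     ≡⟨ cong inv (*-zeroˡ y) ⟩
    inv 0ℚ           ≡⟨ inv-zero ⟩
    0ℚ               ≡⟨ sym (*-zeroˡ (inv y)) ⟩
    0ℚ * inv y       ≡⟨ cong (λ z → inv z * inv y) (sym x≡0) ⟩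
    inv x * inv y    ∎
  by-cases (no _) (yes y≡0) = begin
    inv (x * y)      ≡⟨ cong (λ z → inv (x * z)) y≡0 ⟩
    inv (x * 0ℚ)     ≡⟨ cong inv (*-zeroʳ x) ⟩
    inv 0ℚ           ≡⟨ inv-zero ⟩
    0ℚ               ≡⟨ sym (*-zeroʳ (inv x)) ⟩
    inv x * 0ℚ       ≡⟨ cong (λ z → inv x * inv z) (sym y≡0) ⟩
    inv x * inv y    ∎
  by-cases (no x≢0) (no y≢0) = inv-unique (x * y) (inv x * inv y) (begin
    (x * y) * (inv x * inv y)     ≡⟨ interchange x (inv x) y (inv y) ⟩
    (x * inv x) * (y * inv y)     ≡⟨ cong₂ _*_ (inv-inverseʳ x≢0) (inv-inverseʳ y≢0) ⟩
    1ℚ * 1ℚ                       ≡⟨ *-identityˡ 1ℚ ⟩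
    1ℚ                            ∎)

inv-cancel : ∀ r {u} → u ≢ 0ℚ → u * inv (r * u) ≡ inv r
inv-cancel r {u} u≢0 = begin
  u * inv (r * u)        ≡⟨ cong (u *_) (inv-* r u) ⟩
  u * (inv r * inv u)    ≡⟨ regroup u (inv r) (inv u) ⟩
  inv r * (u * inv u)    ≡⟨ cong (inv r *_) (inv-inverseʳ u≢0) ⟩
  inv r * 1ℚ             ≡⟨ *-identityʳ _ ⟩
  inv r                  ∎
  where
  regroup : ∀ u ir iu → u * (ir * iu) ≡ ir * (u * iu)
  regroup = solve-∀ ℚ-ring

sum-cong : ∀ n {f g : ℕ → ℚ} → (∀ j → j < n → f j ≡ g j) → sumBelow n f ≡ sumBelow n g
sum-cong zero    f≡g = refl
sum-cong (suc n) f≡g = cong₂ _+_ (sum-cong n (λ j j<n → f≡g j (m<n⇒m<1+n j<n))) (f≡g n ≤-refl)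

sum-- : ∀ n (f g : ℕ → ℚ) → sumBelow n (λ j → f j - g j) ≡ sumBelow n f - sumBelow n g
sum-- zero    f g = refl
sum-- (suc n) f g = trans (cong (_+ (f n - g n)) (sum-- n f g))
                          (interchange (sumBelow n f) (sumBelow n g) (f n) (g n))
  where
  interchange : ∀ a b c d → (a - b) + (c - d) ≡ (a + c) - (b + d)
  interchange = solve-∀ ℚ-ring

sum-*ˡ : ∀ n c (f : ℕ → ℚ) → sumBelow n (λ j → c * f j) ≡ c * sumBelow n f
sum-*ˡ zero    c f = sym (*-zeroʳ c)
sum-*ˡ (suc n) c f = trans (cong (_+ (c * f n)) (sum-*ˡ n c f)) (distrib c (sumBelow n f) (f n))
  where
  distrib : ∀ c a b → c * a + c * b ≡ c * (a + b)
  distrib = solve-∀ ℚ-ring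

sum-last-zero : ∀ n (f : ℕ → ℚ) → f n ≡ 0ℚ → sumBelow (suc n) f ≡ sumBelow n f
sum-last-zero n f fn≡0 = trans (cong (λ x → sumBelow n f + x) fn≡0) (+-identityʳ (sumBelow n f))

-- Multiplying a generating polynomial Σ c_j t^j by (1 + k t), seen through the pairing
-- with h: if c′₀ = c₀ and c′_{j+1} = c_{j+1} + k c_j, then
-- Σ_{j≤N} c′_j h_j = Σ_{j≤N} c_j h_j + k Σ_{j<N} c_j h_{j+1}.
sum-recurrence : ∀ N (c c′ h : ℕ → ℚ) k → c′ 0 ≡ c 0 → (∀ j → c′ (suc j) ≡ c (suc j) + k * c j) →
  sumBelow (suc N) (λ j → c′ j * h j)
    ≡ sumBelow (suc N) (λ j → c j * h j) + k * sumBelow N (λ j → c j * h (suc j))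
sum-recurrence zero c c′ h k c′₀ c′ₛ rewrite c′₀ = addZero (c 0 * h 0) k
  where
  addZero : ∀ x k → 0ℚ + x ≡ (0ℚ + x) + k * 0ℚ
  addZero = solve-∀ ℚ-ring
sum-recurrence (suc N) c c′ h k c′₀ c′ₛ = begin
  sumBelow (suc N) (λ j → c′ j * h j) + c′ (suc N) * h (suc N)
    ≡⟨ cong₂ _+_ (sum-recurrence N c c′ h k c′₀ c′ₛ) (cong (_* h (suc N)) (c′ₛ N)) ⟩
  (A + k * B) + (c (suc N) + k * c N) * h (suc N)
    ≡⟨ regroup A B k (c (suc N)) (c N) (h (suc N)) ⟩
  (A + c (suc N) * h (suc N)) + k * (B + c N * h (suc N)) ∎
  where
  A = sumBelow (suc N) (λ j → c j * h j)
  B = sumBelow N (λ j → c j * h (suc j))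
  regroup : ∀ A B k x y h → (A + k * B) + (x + k * y) * h ≡ (A + x * h) + k * (B + y * h)
  regroup = solve-∀ ℚ-ring

coeff-vanish : ∀ m j → m < j → coeff m j ≡ 0ℚ
coeff-vanish zero    (suc j) _ = refl
coeff-vanish (suc m) (suc j) (s≤s m<j)
  rewrite coeff-vanish m (suc j) (m<n⇒m<1+n m<j) | coeff-vanish m j m<j = zeroDiff (+ 1 / suc m)
  where
  zeroDiff : ∀ q → 0ℚ - 0ℚ * q ≡ 0ℚ
  zeroDiff = solve-∀ ℚ-ring

a-vanish : ∀ m j → m < j → a m j ≡ 0ℚ
a-vanish m j m<j = trans (cong (sgn j *_) (coeff-vanish m j m<j)) (*-zeroʳ (sgn j))

sgn-squared : ∀ j → sgn j * sgn j ≡ 1ℚ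
sgn-squared zero    = refl
sgn-squared (suc j) = trans (negSquare (sgn j)) (sgn-squared j)
  where
  negSquare : ∀ x → (- x) * (- x) ≡ x * x
  negSquare = solve-∀ ℚ-ring

Gc : ℕ → ℚ → ℚ
Gc m s = sumBelow (suc m) (λ j → coeff m j * inv (s + ι j - 1ℚ))

G≡Gc : ∀ m s → G m s ≡ Gc m s
G≡Gc m s = sum-cong (suc m) λ j _ → let d = s + ι j - 1ℚ in begin
  (sgn j * (sgn j * coeff m j)) ÷₀ d      ≡⟨ ÷₀-as-inv _ d ⟩
  (sgn j * (sgn j * coeff m j)) * inv d   ≡⟨ regroup (sgn j) (coeff m j) (inv d) ⟩
  (sgn j * sgn j) * (coeff m j * inv d)   ≡⟨ cong (_* (coeff m j * inv d)) (sgn-squared j) ⟩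
  1ℚ * (coeff m j * inv d)                ≡⟨ *-identityˡ _ ⟩
  coeff m j * inv d                       ∎
  where
  regroup : ∀ g c i → (g * (g * c)) * i ≡ (g * g) * (c * i)
  regroup = solve-∀ ℚ-ring

-- Recurrence for G: the new factor (1 - t/(n+1)) shifts j ↦ j+1, i.e. s ↦ s+1.
Gc-recurrence : ∀ n s → Gc (suc n) s ≡ Gc n s + (- (+ 1 / suc n)) * Gc n (s + 1ℚ)
Gc-recurrence n s = begin
  Gc (suc n) s
    ≡⟨ sum-recurrence (suc n) (coeff n) (coeff (suc n)) h (- q) refl
         (λ j → coeff-step (coeff n (suc j)) (coeff n j) q) ⟩
  sumBelow (suc (suc n)) (λ j → coeff n j * h j) + (- q) * sumBelow (suc n) (λ j → coeff n j * h (suc j))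
    ≡⟨ cong₂ (λ X Y → X + (- q) * Y)
         (sum-last-zero (suc n) (λ j → coeff n j * h j)
           (trans (cong (_* h (suc n)) (coeff-vanish n (suc n) ≤-refl)) (*-zeroˡ (h (suc n)))))
         (sum-cong (suc n) (λ j _ → cong (λ d → coeff n j * inv d) (sym (shift j)))) ⟩
  Gc n s + (- q) * Gc n (s + 1ℚ) ∎
  where
  q = + 1 / suc n
  h : ℕ → ℚ
  h j = inv (s + ι j - 1ℚ)
  coeff-step : ∀ x y q → x - y * q ≡ x + (- q) * y
  coeff-step = solve-∀ ℚ-ring
  shift : ∀ j → (s + 1ℚ) + ι j - 1ℚ ≡ s + ι (suc j) - 1ℚ
  shift j = trans (reassoc s (ι j)) (cong (λ x → s + x - 1ℚ) (sym (ι-suc j)))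
    where
    reassoc : ∀ s x → (s + 1ℚ) + x - 1ℚ ≡ s + (1ℚ + x) - 1ℚ
    reassoc = solve-∀ ℚ-ring

T : ℚ → ℕ → ℚ
T s j = ι (suc j !) * inv (risingFrom1 s j)

R : ℕ → ℚ → ℚ
R n s = sumBelow (suc n) (λ j → a n j * T s j)

-- Recurrence for R, from a_{n+1,j+1} = a_{n,j+1} + a_{n,j}/(n+1).
R-recurrence : ∀ n s → R (suc n) s ≡ R n s + (+ 1 / suc n) * sumBelow (suc n) (λ j → a n j * T s (suc j))
R-recurrence n s = begin
  R (suc n) s
    ≡⟨ sum-recurrence (suc n) (a n) (a (suc n)) (T s) q refl
         (λ j → signed-step (sgn j) (coeff n (suc j)) (coeff n j) q) ⟩
  sumBelow (suc (suc n)) (λ j → a n j * T s j) + q * sumBelow (suc n) (λ j → a n j * T s (suc j))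
    ≡⟨ cong (_+ q * sumBelow (suc n) (λ j → a n j * T s (suc j)))
         (sum-last-zero (suc n) (λ j → a n j * T s j)
           (trans (cong (_* T s (suc n)) (a-vanish n (suc n) ≤-refl)) (*-zeroˡ (T s (suc n))))) ⟩
  R n s + q * sumBelow (suc n) (λ j → a n j * T s (suc j)) ∎
  where
  q = + 1 / suc n
  signed-step : ∀ g x y q → (- g) * (x - y * q) ≡ (- g) * x + q * (g * y)
  signed-step = solve-∀ ℚ-ring

rising-shift : ∀ s j → risingFrom1 s (suc j) ≡ (s + 1ℚ) * risingFrom1 (s + 1ℚ) j
rising-shift s zero    = *-comm 1ℚ (s + 1ℚ)
rising-shift s (suc j) = begin
  risingFrom1 s (suc j) * (s + ι (suc (suc j)))
    ≡⟨ cong₂ _*_ (rising-shift s j) (trans (cong (λ x → s + x) (ι-suc (suc j))) (reassoc s (ι (suc j)))) ⟩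
  ((s + 1ℚ) * risingFrom1 (s + 1ℚ) j) * ((s + 1ℚ) + ι (suc j))
    ≡⟨ assoc (s + 1ℚ) (risingFrom1 (s + 1ℚ) j) ((s + 1ℚ) + ι (suc j)) ⟩
  (s + 1ℚ) * risingFrom1 (s + 1ℚ) (suc j) ∎
  where
  reassoc : ∀ s x → s + (1ℚ + x) ≡ (s + 1ℚ) + x
  reassoc = solve-∀ ℚ-ring
  assoc : ∀ p w y → (p * w) * y ≡ p * (w * y)
  assoc = solve-∀ ℚ-ring

-- Telescoping: (s-1)/(s+1) · T_j(s+1) = T_j(s) - T_{j+1}(s), provided s + j + 1 ≠ 0.
-- Both sides equal (j+1)! (s-1) / ((s+1)⋯(s+j+1)), since (s+j+1) - (j+2) = s - 1.
T-telescoping : ∀ s j → s + ι (suc j) ≢ 0ℚ →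
  (s - 1ℚ) * inv (s + 1ℚ) * T (s + 1ℚ) j ≡ T s j - T s (suc j)
T-telescoping s j u≢0 = begin
  (s - 1ℚ) * inv (s + 1ℚ) * (F * inv w)        ≡⟨ regroup (s - 1ℚ) F (inv (s + 1ℚ)) (inv w) ⟩
  (s - 1ℚ) * F * (inv (s + 1ℚ) * inv w)        ≡⟨ cong ((s - 1ℚ) * F *_) (sym (inv-* (s + 1ℚ) w)) ⟩
  (s - 1ℚ) * F * inv ((s + 1ℚ) * w)            ≡⟨ cong (λ d → (s - 1ℚ) * F * inv d) (sym (rising-shift s j)) ⟩
  (s - 1ℚ) * F * Z                             ≡⟨ split s x F Z ⟩
  F * (u * Z) - ((1ℚ + x) * F) * Z             ≡⟨ cong₂ (λ A B → F * A - B * Z) (inv-cancel r u≢0) (sym factorial-step) ⟩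
  F * inv r - ι (suc (suc j) !) * Z            ∎
  where
  r = risingFrom1 s j
  x = ι (suc j)
  u = s + x
  w = risingFrom1 (s + 1ℚ) j
  F = ι (suc j !)
  Z = inv (r * u)
  factorial-step : ι (suc (suc j) !) ≡ (1ℚ + x) * F
  factorial-step = trans (ι-* (suc (suc j)) (suc j !)) (cong (_* F) (ι-suc (suc j)))
  regroup : ∀ K F ip iw → K * ip * (F * iw) ≡ K * F * (ip * iw)
  regroup = solve-∀ ℚ-ring
  split : ∀ s x F Z → (s - 1ℚ) * F * Z ≡ F * ((s + x) * Z) - ((1ℚ + x) * F) * Z
  split = solve-∀ ℚ-ring

-- Summing the telescoping identity against a_{n,j}: the sum in the R-recurrence in closed form.
shifted-R : ∀ n s → (∀ i → i ≤ n → s + ι (suc i) ≢ 0ℚ) →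
  sumBelow (suc n) (λ j → a n j * T s (suc j)) ≡ R n s - (s - 1ℚ) * inv (s + 1ℚ) * R n (s + 1ℚ)
shifted-R n s nonzero = begin
  sumBelow (suc n) (λ j → a n j * T s (suc j))
    ≡⟨ sym (cancel (R n s) _) ⟩
  R n s - (R n s - sumBelow (suc n) (λ j → a n j * T s (suc j)))
    ≡⟨ cong (λ x → R n s - x) (sym (sum-- (suc n) (λ j → a n j * T s j) (λ j → a n j * T s (suc j)))) ⟩
  R n s - sumBelow (suc n) (λ j → a n j * T s j - a n j * T s (suc j))
    ≡⟨ cong (λ x → R n s - x) (sum-cong (suc n) (λ j j≤n → termwise j (nonzero j (ℕ.s≤s⁻¹ j≤n)))) ⟩
  R n s - sumBelow (suc n) (λ j → K * (a n j * T (s + 1ℚ) j))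
    ≡⟨ cong (λ x → R n s - x) (sum-*ˡ (suc n) K (λ j → a n j * T (s + 1ℚ) j)) ⟩
  R n s - K * R n (s + 1ℚ) ∎
  where
  K = (s - 1ℚ) * inv (s + 1ℚ)
  cancel : ∀ R B → R - (R - B) ≡ B
  cancel = solve-∀ ℚ-ring
  distrib : ∀ K A X Y → K * X ≡ Y → K * (A * X) ≡ A * Y
  distrib K A X Y KX≡Y = trans (swap K A X) (cong (A *_) KX≡Y)
    where
    swap : ∀ K A X → K * (A * X) ≡ A * (K * X)
    swap = solve-∀ ℚ-ring
  termwise : ∀ j → s + ι (suc j) ≢ 0ℚ → a n j * T s j - a n j * T s (suc j) ≡ K * (a n j * T (s + 1ℚ) j)
  termwise j u≢0 = sym (trans (distrib K (a n j) _ _ (T-telescoping s j u≢0))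
                              (*-distribˡ-minus (a n j) (T s j) (T s (suc j))))
    where
    *-distribˡ-minus : ∀ A X Y → A * (X - Y) ≡ A * X - A * Y
    *-distribˡ-minus = solve-∀ ℚ-ring

Admissible : ℕ → ℚ → Set
Admissible m s = (j : ℕ) → j ≤ m → s + ι j - 1ℚ ≢ 0ℚ

admissible-pred : ∀ n s → Admissible (suc n) s → Admissible n s
admissible-pred n s adm j j≤n = adm j (m≤n⇒m≤1+n j≤n)

-- ... and for G_n(s+1), whose denominators are those of G_{n+1}(s) with index j ≥ 1.
admissible-shift : ∀ n s → Admissible (suc n) s → Admissible n (s + 1ℚ)
admissible-shift n s adm j j≤n zero≡ = adm (suc j) (s≤s j≤n) (trans (shift j) zero≡)
  where
  shift : ∀ j → s + ι (suc j) - 1ℚ ≡ (s + 1ℚ) + ι j - 1ℚ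
  shift j = trans (cong (λ x → s + x - 1ℚ) (ι-suc j)) (reassoc s (ι j))
    where
    reassoc : ∀ s x → s + (1ℚ + x) - 1ℚ ≡ (s + 1ℚ) + x - 1ℚ
    reassoc = solve-∀ ℚ-ring

admissible-nonzero : ∀ m s → Admissible m s → ∀ i → suc i ≤ m → s + ι i ≢ 0ℚ
admissible-nonzero m s adm i i<m zero≡ = adm (suc i) i<m (trans (shift i) zero≡)
  where
  shift : ∀ i → s + ι (suc i) - 1ℚ ≡ s + ι i
  shift i = trans (cong (λ x → s + x - 1ℚ) (ι-suc i)) (cancelOne s (ι i))
    where
    cancelOne : ∀ s x → s + (1ℚ + x) - 1ℚ ≡ s + x
    cancelOne = solve-∀ ℚ-ring

-- Field arithmetic of the induction step: the G-recurrence at level N′ = N + 1 together with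
-- the induction hypotheses at s and s+1 yields the R-recurrence in closed form.
step-algebra : ∀ N N′ q q′ s ip G₀ G₁ R₀ R₁ →
  N′ ≡ 1ℚ + N → N′ * q ≡ 1ℚ → N * q′ ≡ 1ℚ → (s + 1ℚ) * ip ≡ 1ℚ →
  N * s * (s - 1ℚ) * G₀ ≡ R₀ → N * (s + 1ℚ) * ((s + 1ℚ) - 1ℚ) * G₁ ≡ R₁ →
  N′ * s * (s - 1ℚ) * (G₀ + (- q) * G₁) ≡ R₀ + q′ * (R₀ - (s - 1ℚ) * ip * R₁)
step-algebra N N′ q q′ s ip G₀ G₁ R₀ R₁ refl N′q≡1 Nq′≡1 p·ip≡1 refl refl = begin
  N′ * s * (s - 1ℚ) * (G₀ + (- q) * G₁)
    ≡⟨ expandL N q s G₀ G₁ ⟩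
  N′ * s * (s - 1ℚ) * G₀ - (N′ * q) * (s * (s - 1ℚ) * G₁)
    ≡⟨ cong (λ c → N′ * s * (s - 1ℚ) * G₀ - c * (s * (s - 1ℚ) * G₁)) N′q≡1 ⟩
  N′ * s * (s - 1ℚ) * G₀ - 1ℚ * (s * (s - 1ℚ) * G₁)
    ≡⟨ collect N s G₀ G₁ ⟩
  N * s * (s - 1ℚ) * G₀ + 1ℚ * (s * (s - 1ℚ) * G₀) - 1ℚ * 1ℚ * (s * (s - 1ℚ) * G₁)
    ≡⟨ cong₂ (λ c d → N * s * (s - 1ℚ) * G₀ + c * (s * (s - 1ℚ) * G₀) - c * d * (s * (s - 1ℚ) * G₁))
         (sym Nq′≡1) (sym p·ip≡1) ⟩
  N * s * (s - 1ℚ) * G₀ + (N * q′) * (s * (s - 1ℚ) * G₀) - (N * q′) * ((s + 1ℚ) * ip) * (s * (s - 1ℚ) * G₁)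
    ≡⟨ expandR N q′ s ip G₀ G₁ ⟩
  R₀ + q′ * (R₀ - (s - 1ℚ) * ip * R₁) ∎
  where
  expandL : ∀ N q s G₀ G₁ → (1ℚ + N) * s * (s - 1ℚ) * (G₀ + (- q) * G₁)
    ≡ (1ℚ + N) * s * (s - 1ℚ) * G₀ - ((1ℚ + N) * q) * (s * (s - 1ℚ) * G₁)
  expandL = solve-∀ ℚ-ring
  collect : ∀ N s G₀ G₁ → (1ℚ + N) * s * (s - 1ℚ) * G₀ - 1ℚ * (s * (s - 1ℚ) * G₁)
    ≡ N * s * (s - 1ℚ) * G₀ + 1ℚ * (s * (s - 1ℚ) * G₀) - 1ℚ * 1ℚ * (s * (s - 1ℚ) * G₁)
  collect = solve-∀ ℚ-ring
  expandR : ∀ N q′ s ip G₀ G₁ →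
    N * s * (s - 1ℚ) * G₀ + (N * q′) * (s * (s - 1ℚ) * G₀) - (N * q′) * ((s + 1ℚ) * ip) * (s * (s - 1ℚ) * G₁)
    ≡ N * s * (s - 1ℚ) * G₀
      + q′ * (N * s * (s - 1ℚ) * G₀ - (s - 1ℚ) * ip * (N * (s + 1ℚ) * ((s + 1ℚ) - 1ℚ) * G₁))
  expandR = solve-∀ ℚ-ring

base-case : ∀ s → Admissible 1 s → ι 1 * s * (s - 1ℚ) * Gc 1 s ≡ R 0 s
base-case s adm = begin
  ι 1 * s * (s - 1ℚ) * Gc 1 s
    ≡⟨ expand s (inv (s + ι 0 - 1ℚ)) (inv (s + ι 1 - 1ℚ)) ⟩
  s * ((s + ι 0 - 1ℚ) * inv (s + ι 0 - 1ℚ)) - (s - 1ℚ) * ((s + ι 1 - 1ℚ) * inv (s + ι 1 - 1ℚ))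
    ≡⟨ cong₂ (λ x y → s * x - (s - 1ℚ) * y) (inv-inverseʳ (adm 0 z≤n)) (inv-inverseʳ (adm 1 ≤-refl)) ⟩
  s * 1ℚ - (s - 1ℚ) * 1ℚ
    ≡⟨ difference s ⟩
  R 0 s ∎
  where
  expand : ∀ s iu iv → 1ℚ * s * (s - 1ℚ) * ((0ℚ + 1ℚ * iu) + (- 1ℚ) * iv)
    ≡ s * ((s + 0ℚ - 1ℚ) * iu) - (s - 1ℚ) * ((s + 1ℚ - 1ℚ) * iv)
  expand = solve-∀ ℚ-ring
  difference : ∀ s → s * 1ℚ - (s - 1ℚ) * 1ℚ ≡ 1ℚ
  difference = solve-∀ ℚ-ring

scaled-G≡R : ∀ n s → Admissible (suc n) s → ι (suc n) * s * (s - 1ℚ) * Gc (suc n) s ≡ R n s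
scaled-G≡R zero    s adm = base-case s adm
scaled-G≡R (suc n) s adm = begin
  ι (suc (suc n)) * s * (s - 1ℚ) * Gc (suc (suc n)) s
    ≡⟨ cong (ι (suc (suc n)) * s * (s - 1ℚ) *_) (Gc-recurrence (suc n) s) ⟩
  ι (suc (suc n)) * s * (s - 1ℚ) * (Gc (suc n) s + (- q) * Gc (suc n) (s + 1ℚ))
    ≡⟨ step-algebra (ι (suc n)) (ι (suc (suc n))) q q′ s (inv (s + 1ℚ)) _ _ _ _
         (ι-suc (suc n)) (ι-reciprocal (suc n)) (ι-reciprocal n)
         (inv-inverseʳ (nonzero 1 (s≤s (s≤s z≤n))))
         (scaled-G≡R n s (admissible-pred (suc n) s adm))
         (scaled-G≡R n (s + 1ℚ) (admissible-shift (suc n) s adm)) ⟩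
  R n s + q′ * (R n s - (s - 1ℚ) * inv (s + 1ℚ) * R n (s + 1ℚ))
    ≡⟨ cong (λ B → R n s + q′ * B) (sym (shifted-R n s (λ i i≤n → nonzero (suc i) (s≤s (s≤s i≤n))))) ⟩
  R n s + q′ * sumBelow (suc n) (λ j → a n j * T s (suc j))
    ≡⟨ sym (R-recurrence n s) ⟩
  R (suc n) s ∎
  where
  q  = + 1 / suc (suc n)
  q′ = + 1 / suc n
  nonzero : ∀ i → suc i ≤ suc (suc n) → s + ι i ≢ 0ℚ
  nonzero = admissible-nonzero (suc (suc n)) s adm

mainTheorem1 : (m : ℕ) → 1 ≤ m → (s : ℚ) → ((j : ℕ) → j ≤ m → s + ι j - 1ℚ ≢ 0ℚ) →
    ι m * s * (s - 1ℚ) * G m s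
      ≡ sumBelow m (λ j → (ι ((suc j) !) * a (m ∸ 1) j) ÷₀ risingFrom1 s j)
mainTheorem1 zero    () s adm
mainTheorem1 (suc n) _  s adm = begin
  ι (suc n) * s * (s - 1ℚ) * G (suc n) s    ≡⟨ cong (ι (suc n) * s * (s - 1ℚ) *_) (G≡Gc (suc n) s) ⟩
  ι (suc n) * s * (s - 1ℚ) * Gc (suc n) s   ≡⟨ scaled-G≡R n s adm ⟩
  R n s                                      ≡⟨ sum-cong (suc n) (λ j _ → as-quotient (a n j) j) ⟩
  sumBelow (suc n) (λ j → (ι (suc j !) * a n j) ÷₀ risingFrom1 s j) ∎
  where
  as-quotient : ∀ c j → c * T s j ≡ (ι (suc j !) * c) ÷₀ risingFrom1 s j
  as-quotient c j = sym (trans (÷₀-as-inv (ι (suc j !) * c) (risingFrom1 s j)) (regroup (ι (suc j !)) c (inv (risingFrom1 s j))))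
    where
    regroup : ∀ F c i → (F * c) * i ≡ c * (F * i)
    regroup = solve-∀ ℚ-ring
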